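{- Let $A$ and $B$ be $\delta$-algebras and let $h\colon A\to B$ be any homomorphism of the underlying MV-algebras. Then for every $n\in\mathbb{N}$ and every $x\in A$, $h(f_{1/2^n}(x))=f_{1/2^n}(h(x))$.
   Context: An MV-algebra is a structure $(A,\oplus,\neg,0)$ such that $(A,\oplus,0)$ is a commutative monoid, $\neg\neg x=x$, $x\oplus\neg 0=\neg 0$, and $\neg(\neg x\oplus y)\oplus y=\neg(\neg y\oplus x)\oplus x$. Write $1:=\neg 0$, $x\odot y:=\neg(\neg x\oplus\neg y)$, $x\ominus y:=x\odot\neg y$, $d(x,y):=(x\ominus y)\oplus(y\ominus x)$; $x\le y$ iff $x\ominus y=0$ defines a lattice order with $x\vee y=\neg(\neg x\oplus y)\oplus y$. A $\delta$-algebra is a structure $(A,\delta,\oplus,\neg,0)$ where $(A,\oplus,\neg,0)$ is an MV-algebra and $\delta$ is an operation of countably infinite arity such that, writing $\vec x=(x_1,x_2,\ldots)$, $\vec 0=(0,0,\ldots)$ and $f_{1/2}(x):=\delta(x,\vec 0)$: (A1) $d(\delta(\vec x),\delta(x_1,\vec 0))=\delta(0,x_2,x_3,\ldots)$; (A2) $f_{1/2}(\delta(\vec x))=\delta(f_{1/2}(x_1),f_{1/2}(x_2),\ldots)$; (A3) $\delta(x,x,\ldots)=x$; (A4) $\delta(0,\vec x)=f_{1/2}(\delta(\vec x))$; (A5) $\delta(x_1\oplus y_1,x_2\oplus y_2,\ldots)\ge\delta(x_1,x_2,\ldots)$; (A6) $f_{1/2}(x\ominus y)=f_{1/2}(x)\ominus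 f_{1/2}(y)$. For $n\in\mathbb{N}$, $f_{1/2^n}$ denotes the $n$-fold iterate of $f_{1/2}$. -}

module Defs where

open import Level using (Level; _⊔_)
open import Data.Nat using (ℕ; zero; suc)
open import Relation.Binary.PropositionalEquality using (_≡_)

record MVAlgebra (a : Level) : Set (Level.suc a) where
  infixl 6 _⊕_
  field
    Carrier : Set a
    _⊕_     : Carrier → Carrier → Carrier
    neg     : Carrier → Carrier
    zero'   : Carrier
    ⊕-assoc    : ∀ x y z → (x ⊕ y) ⊕ z ≡ x ⊕ (y ⊕ z)
    ⊕-comm     : ∀ x y → x ⊕ y ≡ y ⊕ x
    ⊕-identity : ∀ x → x ⊕ zero' ≡ x
    neg-invol  : ∀ x → neg (neg x) ≡ x
    ⊕-absorb   : ∀ x → x ⊕ neg zero' ≡ neg zero'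
    luk        : ∀ x y → neg (neg x ⊕ y) ⊕ y ≡ neg (neg y ⊕ x) ⊕ x

  one : Carrier
  one = neg zero'

  _⊙_ : Carrier → Carrier → Carrier
  x ⊙ y = neg (neg x ⊕ neg y)

  _⊖_ : Carrier → Carrier → Carrier
  x ⊖ y = x ⊙ neg y

  dist : Carrier → Carrier → Carrier
  dist x y = (x ⊖ y) ⊕ (y ⊖ x)

  _≤_ : Carrier → Carrier → Set a
  x ≤ y = x ⊖ y ≡ zero'

-- Sequences x⃗ = (x₁, x₂, …) are functions ℕ → A, with index 0 for x₁.
cons : ∀ {a} {A : Set a} → A → (ℕ → A) → (ℕ → A)
cons x s zero    = x
cons x s (suc n) = s n

const : ∀ {a} {A : Set a} → A → (ℕ → A)
const x _ = x

record DeltaAlgebra (a : Level) : Set (Level.suc a) where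
  field
    mv : MVAlgebra a
  open MVAlgebra mv public
  field
    δ : (ℕ → Carrier) → Carrier

  f½ : Carrier → Carrier
  f½ x = δ (cons x (const zero'))

  field
    A1 : ∀ (x : ℕ → Carrier) →
         dist (δ x) (δ (cons (x 0) (const zero'))) ≡ δ (cons zero' (λ n → x (suc n)))
    A2 : ∀ (x : ℕ → Carrier) → f½ (δ x) ≡ δ (λ n → f½ (x n))
    A3 : ∀ x → δ (const x) ≡ x
    A4 : ∀ (x : ℕ → Carrier) → δ (cons zero' x) ≡ f½ (δ x)
    A5 : ∀ (x y : ℕ → Carrier) → δ x ≤ δ (λ n → x n ⊕ y n)
    A6 : ∀ x y → f½ (x ⊖ y) ≡ f½ x ⊖ f½ y

  f½^ : ℕ → Carrier → Carrier
  f½^ zero    x = x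
  f½^ (suc n) x = f½ (f½^ n x)

record IsMVHom {a b : Level} (A : MVAlgebra a) (B : MVAlgebra b)
               (h : MVAlgebra.Carrier A → MVAlgebra.Carrier B) : Set (a ⊔ b) where
  private
    module A = MVAlgebra A
    module B = MVAlgebra B
  field
    pres-⊕ : ∀ x y → h (x A.⊕ y) ≡ h x B.⊕ h y
    pres-neg : ∀ x → h (A.neg x) ≡ B.neg (h x)
    pres-0 : h A.zero' ≡ B.zero'

-- In a δ-algebra, A1, A3 and A4 give dist(x, f½ x) = f½ x, and A6 yields f½ x ≤ x, so
-- x ⊖ f½ x = f½ x: f½ x is a half of x. In every MV-algebra a half is unique
-- (x = (x ∧ y) ⊕ (x ⊖ y) with ∧ symmetric), and MV-homomorphisms preserve ⊖, hence
-- halves; so h (f½ x) = f½ (h x), and the claim follows by induction on n.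
module Submission where

open import Defs
open import Level using (Level)
open import Data.Nat using (ℕ; zero; suc)
open import Relation.Binary.PropositionalEquality
  using (_≡_; refl; sym; trans; cong; cong₂; subst; module ≡-Reasoning)
open ≡-Reasoning

module MVProperties {a : Level} (M : MVAlgebra a) where
  open MVAlgebra M

  neg-one : neg one ≡ zero'
  neg-one = neg-invol zero'

  ⊕-identityˡ : ∀ x → zero' ⊕ x ≡ x
  ⊕-identityˡ x = trans (⊕-comm _ _) (⊕-identity x)

  ⊕-absorbˡ : ∀ x → one ⊕ x ≡ one
  ⊕-absorbˡ x = trans (⊕-comm _ _) (⊕-absorb x)

  ⊕-complementˡ : ∀ x → neg x ⊕ x ≡ one
  ⊕-complementˡ x = begin
    neg x ⊕ x               ≡⟨ cong (λ t → neg t ⊕ x) (sym (trans (cong (_⊕ x) neg-one) (⊕-identityˡ x))) ⟩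
    neg (neg one ⊕ x) ⊕ x   ≡⟨ sym (luk x one) ⟩
    neg (neg x ⊕ one) ⊕ one ≡⟨ ⊕-absorb _ ⟩
    one                     ∎

  ⊙-complementʳ : ∀ x → x ⊙ neg x ≡ zero'
  ⊙-complementʳ x = trans (cong (λ t → neg (neg x ⊕ t)) (neg-invol x))
                          (trans (cong neg (⊕-complementˡ x)) neg-one)

  ⊙-zeroˡ : ∀ x → zero' ⊙ x ≡ zero'
  ⊙-zeroˡ x = trans (cong neg (⊕-absorbˡ (neg x))) neg-one

  ⊙-zeroʳ : ∀ x → x ⊙ zero' ≡ zero'
  ⊙-zeroʳ x = trans (cong neg (⊕-absorb (neg x))) neg-one

  ⊙-identityˡ : ∀ x → one ⊙ x ≡ x
  ⊙-identityˡ x = trans (cong (λ t → neg (t ⊕ neg x)) neg-one)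
                        (trans (cong neg (⊕-identityˡ (neg x))) (neg-invol x))

  ⊙-comm : ∀ x y → x ⊙ y ≡ y ⊙ x
  ⊙-comm x y = cong neg (⊕-comm _ _)

  ⊙-assoc : ∀ x y z → (x ⊙ y) ⊙ z ≡ x ⊙ (y ⊙ z)
  ⊙-assoc x y z = begin
    neg (neg (neg (neg x ⊕ neg y)) ⊕ neg z) ≡⟨ cong (λ t → neg (t ⊕ neg z)) (neg-invol _) ⟩
    neg ((neg x ⊕ neg y) ⊕ neg z)           ≡⟨ cong neg (⊕-assoc _ _ _) ⟩
    neg (neg x ⊕ (neg y ⊕ neg z))           ≡⟨ cong (λ t → neg (neg x ⊕ t)) (sym (neg-invol _)) ⟩
    neg (neg x ⊕ neg (neg (neg y ⊕ neg z))) ∎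

  ⊙-swapʳ : ∀ x y z → (x ⊙ y) ⊙ z ≡ (x ⊙ z) ⊙ y
  ⊙-swapʳ x y z = trans (⊙-assoc x y z) (trans (cong (x ⊙_) (⊙-comm y z)) (sym (⊙-assoc x z y)))

  ≤⇒neg⊕≡one : ∀ {x y} → x ≤ y → neg x ⊕ y ≡ one
  ≤⇒neg⊕≡one {x} {y} x≤y = begin
    neg x ⊕ y                       ≡⟨ cong (neg x ⊕_) (sym (neg-invol y)) ⟩
    neg x ⊕ neg (neg y)             ≡⟨ sym (neg-invol _) ⟩
    neg (neg (neg x ⊕ neg (neg y))) ≡⟨ cong neg x≤y ⟩
    one                             ∎

  neg⊕≡one⇒≤ : ∀ {x y} → neg x ⊕ y ≡ one → x ≤ y
  neg⊕≡one⇒≤ {x} {y} eq = trans (cong (λ t → neg (neg x ⊕ t)) (neg-invol y)) (trans (cong neg eq) neg-one)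

  x≤x⊕y : ∀ x y → x ≤ (x ⊕ y)
  x≤x⊕y x y = neg⊕≡one⇒≤ (trans (sym (⊕-assoc _ _ _))
                                (trans (cong (_⊕ y) (⊕-complementˡ x)) (⊕-absorbˡ y)))

  x≤one : ∀ x → x ≤ one
  x≤one x = trans (cong (x ⊙_) neg-one) (⊙-zeroʳ x)

  x⊖y≤x : ∀ x y → (x ⊖ y) ≤ x
  x⊖y≤x x y = trans (⊙-swapʳ x (neg y) (neg x))
                    (trans (cong (_⊙ neg y) (⊙-complementʳ x)) (⊙-zeroˡ (neg y)))

  ≤-trans : ∀ {x y z} → x ≤ y → y ≤ z → x ≤ z
  ≤-trans {x} {y} {z} x≤y y≤z = neg⊕≡one⇒≤ (begin
    neg x ⊕ z        ≡⟨ cong (neg x ⊕_) z≡w⊕y ⟩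
    neg x ⊕ (w ⊕ y)  ≡⟨ cong (neg x ⊕_) (⊕-comm w y) ⟩
    neg x ⊕ (y ⊕ w)  ≡⟨ sym (⊕-assoc _ _ _) ⟩
    (neg x ⊕ y) ⊕ w  ≡⟨ cong (_⊕ w) (≤⇒neg⊕≡one x≤y) ⟩
    one ⊕ w          ≡⟨ ⊕-absorbˡ w ⟩
    one              ∎)
    where
    w = neg (neg z ⊕ y)
    z≡w⊕y : z ≡ w ⊕ y
    z≡w⊕y = begin
      z                     ≡⟨ sym (⊕-identityˡ z) ⟩
      zero' ⊕ z             ≡⟨ cong (_⊕ z) (sym neg-one) ⟩
      neg one ⊕ z           ≡⟨ cong (λ t → neg t ⊕ z) (sym (≤⇒neg⊕≡one y≤z)) ⟩
      neg (neg y ⊕ z) ⊕ z   ≡⟨ luk y z ⟩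
      w ⊕ y                 ∎

  ⊕-⊖-cancelˡ : ∀ {x y} → y ≤ neg x → (x ⊕ y) ⊖ x ≡ y
  ⊕-⊖-cancelˡ {x} {y} y≤¬x = begin
    neg (neg (x ⊕ y) ⊕ neg (neg x))       ≡⟨ cong (λ t → neg (neg (x ⊕ y) ⊕ t)) (neg-invol x) ⟩
    neg (neg (x ⊕ y) ⊕ x)                 ≡⟨ cong (λ t → neg (neg t ⊕ x)) (⊕-comm x y) ⟩
    neg (neg (y ⊕ x) ⊕ x)                 ≡⟨ cong (λ t → neg (neg (t ⊕ x) ⊕ x)) (sym (neg-invol y)) ⟩
    neg (neg (neg (neg y) ⊕ x) ⊕ x)       ≡⟨ cong neg (luk (neg y) x) ⟩
    neg (neg (neg x ⊕ neg y) ⊕ neg y)     ≡⟨ cong (λ t → neg (neg t ⊕ neg y)) ¬x⊕¬y≡one ⟩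
    neg (neg one ⊕ neg y)                 ≡⟨ cong (λ t → neg (t ⊕ neg y)) neg-one ⟩
    neg (zero' ⊕ neg y)                   ≡⟨ cong neg (⊕-identityˡ (neg y)) ⟩
    neg (neg y)                           ≡⟨ neg-invol y ⟩
    y                                     ∎
    where
    ¬x⊕¬y≡one : neg x ⊕ neg y ≡ one
    ¬x⊕¬y≡one = trans (⊕-comm _ _) (≤⇒neg⊕≡one y≤¬x)

  neg-⊖-⊖ : ∀ x u y → neg x ⊖ (u ⊖ y) ≡ (neg u ⊕ y) ⊖ x
  neg-⊖-⊖ x u y = begin
    neg x ⊙ neg (neg (neg u ⊕ neg (neg y))) ≡⟨ cong (neg x ⊙_) (neg-invol _) ⟩
    neg x ⊙ (neg u ⊕ neg (neg y))           ≡⟨ cong (λ t → neg x ⊙ (neg u ⊕ t)) (neg-invol y) ⟩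
    neg x ⊙ (neg u ⊕ y)                     ≡⟨ ⊙-comm _ _ ⟩
    (neg u ⊕ y) ⊙ neg x                     ∎

  _∧_ : Carrier → Carrier → Carrier
  x ∧ y = x ⊖ (x ⊖ y)

  ∧-comm : ∀ x y → x ∧ y ≡ y ∧ x
  ∧-comm x y = trans (meet-form x y) (trans (cong neg (luk-neg x y)) (sym (meet-form y x)))
    where
    meet-form : ∀ x y → x ∧ y ≡ neg (neg (neg x ⊕ y) ⊕ neg x)
    meet-form x y = begin
      neg (neg x ⊕ neg (neg (neg (neg x ⊕ neg (neg y))))) ≡⟨ cong (λ t → neg (neg x ⊕ t)) (neg-invol _) ⟩
      neg (neg x ⊕ neg (neg x ⊕ neg (neg y)))             ≡⟨ cong (λ t → neg (neg x ⊕ neg (neg x ⊕ t))) (neg-invol y) ⟩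
      neg (neg x ⊕ neg (neg x ⊕ y))                       ≡⟨ cong neg (⊕-comm _ _) ⟩
      neg (neg (neg x ⊕ y) ⊕ neg x)                       ∎
    luk-neg : ∀ x y → neg (neg x ⊕ y) ⊕ neg x ≡ neg (neg y ⊕ x) ⊕ neg y
    luk-neg x y = begin
      neg (neg x ⊕ y) ⊕ neg x             ≡⟨ cong (λ t → neg t ⊕ neg x) (⊕-comm _ _) ⟩
      neg (y ⊕ neg x) ⊕ neg x             ≡⟨ cong (λ t → neg (t ⊕ neg x) ⊕ neg x) (sym (neg-invol y)) ⟩
      neg (neg (neg y) ⊕ neg x) ⊕ neg x   ≡⟨ luk (neg y) (neg x) ⟩
      neg (neg (neg x) ⊕ neg y) ⊕ neg y   ≡⟨ cong (λ t → neg (t ⊕ neg y) ⊕ neg y) (neg-invol x) ⟩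
      neg (x ⊕ neg y) ⊕ neg y             ≡⟨ cong (λ t → neg t ⊕ neg y) (⊕-comm _ _) ⟩
      neg (neg y ⊕ x) ⊕ neg y             ∎

  ∧-⊕-⊖ : ∀ x y → (x ∧ y) ⊕ (x ⊖ y) ≡ x
  ∧-⊕-⊖ x y = begin
    neg (neg x ⊕ neg (neg u)) ⊕ u   ≡⟨ cong (λ t → neg (neg x ⊕ t) ⊕ u) (neg-invol u) ⟩
    neg (neg x ⊕ u) ⊕ u             ≡⟨ luk x u ⟩
    neg (neg u ⊕ x) ⊕ x             ≡⟨ cong (λ t → neg (neg u ⊕ t) ⊕ x) (sym (neg-invol x)) ⟩
    (u ⊖ x) ⊕ x                     ≡⟨ cong (_⊕ x) (x⊖y≤x x y) ⟩
    zero' ⊕ x                       ≡⟨ ⊕-identityˡ x ⟩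
    x                               ∎
    where
    u = x ⊖ y

  ⊖-sym⇒≡ : ∀ {x y} → x ⊖ y ≡ y ⊖ x → x ≡ y
  ⊖-sym⇒≡ {x} {y} eq = trans (sym (∧-⊕-⊖ x y)) (trans (cong₂ _⊕_ (∧-comm x y) eq) (∧-⊕-⊖ y x))

  IsHalfOf : Carrier → Carrier → Set a
  IsHalfOf y x = x ⊖ y ≡ y

  half-unique : ∀ {x y z} → IsHalfOf y x → IsHalfOf z x → y ≡ z
  half-unique {x} {y} {z} y½ z½ = ⊖-sym⇒≡ (begin
    y ⊖ z        ≡⟨ cong (_⊖ z) (sym y½) ⟩
    (x ⊖ y) ⊖ z  ≡⟨ ⊙-swapʳ x (neg y) (neg z) ⟩
    (x ⊖ z) ⊖ y  ≡⟨ cong (_⊖ y) z½ ⟩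
    z ⊖ y        ∎)

module MVHomProperties {a b : Level} {A : MVAlgebra a} {B : MVAlgebra b}
                       {h : MVAlgebra.Carrier A → MVAlgebra.Carrier B} (hom : IsMVHom A B h) where
  private
    module A = MVAlgebra A
    module B = MVAlgebra B
  open IsMVHom hom

  pres-⊙ : ∀ x y → h (x A.⊙ y) ≡ h x B.⊙ h y
  pres-⊙ x y = trans (pres-neg _) (cong B.neg (trans (pres-⊕ _ _) (cong₂ B._⊕_ (pres-neg x) (pres-neg y))))

  pres-⊖ : ∀ x y → h (x A.⊖ y) ≡ h x B.⊖ h y
  pres-⊖ x y = trans (pres-⊙ x (A.neg y)) (cong (h x B.⊙_) (pres-neg y))

  pres-IsHalfOf : ∀ {x y} → MVProperties.IsHalfOf A y x → MVProperties.IsHalfOf B (h y) (h x)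
  pres-IsHalfOf {x} {y} y½ = trans (sym (pres-⊖ x y)) (cong h y½)

module DeltaProperties {a : Level} (D : DeltaAlgebra a) where
  open DeltaAlgebra D
  open MVProperties mv

  dist-f½ : ∀ x → dist x (f½ x) ≡ f½ x
  dist-f½ x = begin
    dist x (f½ x)              ≡⟨ cong (λ t → dist t (f½ x)) (sym (A3 x)) ⟩
    dist (δ (const x)) (f½ x)  ≡⟨ A1 (const x) ⟩
    δ (cons zero' (const x))   ≡⟨ A4 (const x) ⟩
    f½ (δ (const x))           ≡⟨ cong f½ (A3 x) ⟩
    f½ x                       ∎

  f½-zero : f½ zero' ≡ zero'
  f½-zero = begin
    f½ zero'             ≡⟨ cong f½ (sym (⊙-complementʳ zero')) ⟩
    f½ (zero' ⊖ zero')   ≡⟨ A6 zero' zero' ⟩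
    f½ zero' ⊖ f½ zero'  ≡⟨ ⊙-complementʳ (f½ zero') ⟩
    zero'                ∎

  f½-mono : ∀ {x y} → x ≤ y → f½ x ≤ f½ y
  f½-mono {x} {y} x≤y = trans (sym (A6 x y)) (trans (cong f½ x≤y) f½-zero)

  f½-neg : ∀ x → f½ (neg x) ≡ f½ one ⊖ f½ x
  f½-neg x = trans (cong f½ (sym (⊙-identityˡ (neg x)))) (A6 one x)

  neg-f½-one : neg (f½ one) ≡ f½ one
  neg-f½-one = begin
    neg (f½ one)          ≡⟨ sym (⊕-identity _) ⟩
    neg (f½ one) ⊕ zero'  ≡⟨ cong₂ _⊕_ (sym (⊙-identityˡ _)) (sym (x≤one _)) ⟩
    dist one (f½ one)     ≡⟨ dist-f½ one ⟩
    f½ one                ∎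

  -- dist-f½ at ¬x bounds (f½ 1 ⊕ f½ x) ⊖ x by f½ 1, and (f½ 1 ⊕ f½ x) ⊖ f½ 1 = f½ x
  -- because f½ 1 is its own negation.
  f½-≤ : ∀ x → f½ x ≤ x
  f½-≤ x = begin
    y ⊖ x                  ≡⟨ cong (_⊖ x) (sym (⊕-⊖-cancelˡ y≤¬c)) ⟩
    ((c ⊕ y) ⊖ c) ⊖ x      ≡⟨ ⊙-swapʳ _ _ _ ⟩
    ((c ⊕ y) ⊖ x) ⊖ c      ≡⟨ ≤-trans lhs≤c⊖y (x⊖y≤x c y) ⟩
    zero'                  ∎
    where
    c = f½ one
    y = f½ x
    y≤¬c : y ≤ neg c
    y≤¬c = subst (y ≤_) (sym neg-f½-one) (f½-mono (x≤one x))
    ¬x⊖f½¬x≤f½¬x : (neg x ⊖ f½ (neg x)) ≤ f½ (neg x)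
    ¬x⊖f½¬x≤f½¬x = subst ((neg x ⊖ f½ (neg x)) ≤_) (dist-f½ (neg x)) (x≤x⊕y _ (f½ (neg x) ⊖ neg x))
    lhs≡ : neg x ⊖ (c ⊖ y) ≡ (c ⊕ y) ⊖ x
    lhs≡ = trans (neg-⊖-⊖ x c y) (cong (λ t → (t ⊕ y) ⊖ x) neg-f½-one)
    lhs≤c⊖y : ((c ⊕ y) ⊖ x) ≤ (c ⊖ y)
    lhs≤c⊖y = subst (_≤ (c ⊖ y)) lhs≡ (subst (λ t → (neg x ⊖ t) ≤ t) (f½-neg x) ¬x⊖f½¬x≤f½¬x)

  f½-isHalfOf : ∀ x → IsHalfOf (f½ x) x
  f½-isHalfOf x = begin
    x ⊖ f½ x            ≡⟨ sym (⊕-identity _) ⟩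
    (x ⊖ f½ x) ⊕ zero'  ≡⟨ cong ((x ⊖ f½ x) ⊕_) (sym (f½-≤ x)) ⟩
    dist x (f½ x)       ≡⟨ dist-f½ x ⟩
    f½ x                ∎

module DeltaMVHom {a b : Level} {A : DeltaAlgebra a} {B : DeltaAlgebra b}
                  {h : DeltaAlgebra.Carrier A → DeltaAlgebra.Carrier B}
                  (hom : IsMVHom (DeltaAlgebra.mv A) (DeltaAlgebra.mv B) h) where
  private
    module A = DeltaAlgebra A
    module B = DeltaAlgebra B

  pres-f½ : ∀ x → h (A.f½ x) ≡ B.f½ (h x)
  pres-f½ x = MVProperties.half-unique B.mv
    (MVHomProperties.pres-IsHalfOf hom (DeltaProperties.f½-isHalfOf A x))
    (DeltaProperties.f½-isHalfOf B (h x))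

  pres-f½^ : ∀ n x → h (A.f½^ n x) ≡ B.f½^ n (h x)
  pres-f½^ zero    x = refl
  pres-f½^ (suc n) x = begin
    h (A.f½ (A.f½^ n x))   ≡⟨ pres-f½ (A.f½^ n x) ⟩
    B.f½ (h (A.f½^ n x))   ≡⟨ cong B.f½ (pres-f½^ n x) ⟩
    B.f½ (B.f½^ n (h x))   ∎

lemma6p1 : ∀ {a b : Level} (A : DeltaAlgebra a) (B : DeltaAlgebra b)
             (h : DeltaAlgebra.Carrier A → DeltaAlgebra.Carrier B) →
             IsMVHom (DeltaAlgebra.mv A) (DeltaAlgebra.mv B) h →
             ∀ (n : ℕ) (x : DeltaAlgebra.Carrier A) →
             h (DeltaAlgebra.f½^ A n x) ≡ DeltaAlgebra.f½^ B n (h x)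
lemma6p1 A B h hom = DeltaMVHom.pres-f½^ hom
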